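{- Let $\Sigma$ be a totally ordered alphabet with $|\Sigma| > n$. For every permutation $\pi$ of $[n]$, any one-pass deterministic streaming algorithm that computes $\mathrm{LIS}(x)$ for all $x \in \Sigma^n$ given in the streaming order $\pi$ must use $\Omega(n)$ space.
   Context: For $x = x_1 \cdots x_n \in \Sigma^n$, $\mathrm{LIS}(x)$ is the length of a longest strictly increasing subsequence of $x$. A streaming order is a permutation $\pi = \pi_1 \cdots \pi_n$ of $[n]$; the algorithm receives $x_{\pi_1}, x_{\pi_2}, \dots, x_{\pi_n}$ in this order, once. Space is measured in bits. -}

module Defs where

open import Level using (0ℓ)
open import Data.Nat using (ℕ; zero; suc; _≤_; _*_)
open import Data.Fin using (Fin; zero; suc; _<_)
open import Data.Fin.Permutation using (Permutation′; _⟨$⟩ʳ_)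
open import Data.Bool using (Bool)
open import Data.Vec using (Vec)
open import Data.Product using (Σ; _×_)
open import Relation.Binary.Bundles using (StrictTotalOrder)
open import Relation.Binary.PropositionalEquality using (_≡_)

-- Words x ∈ Σ^n are functions Fin n → Σ (position i ↦ x_{i+1}).

module _ (O : StrictTotalOrder 0ℓ 0ℓ 0ℓ) where
  open StrictTotalOrder O renaming (Carrier to A; _<_ to _⊏_)

  IncSubseq : {n : ℕ} → (Fin n → A) → ℕ → Set
  IncSubseq {n} x k =
    Σ (Fin k → Fin n) λ f →
      (∀ i j → i < j → f i < f j) × (∀ i j → i < j → x (f i) ⊏ x (f j))

  IsLIS : {n : ℕ} → (Fin n → A) → ℕ → Set
  IsLIS x k = IncSubseq x k × (∀ m → IncSubseq x m → m ≤ k)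

-- |Σ| > n : there are n+1 pairwise distinct (inequivalent) letters.
CardGt : (O : StrictTotalOrder 0ℓ 0ℓ 0ℓ) → ℕ → Set
CardGt O n = Σ (Fin (suc n) → Carrier) λ f → ∀ i j → f i ≈ f j → i ≡ j
  where open StrictTotalOrder O

-- A one-pass deterministic streaming algorithm on inputs of length n over
-- alphabet A using s bits of memory: the memory is a bit string of length s,
-- there is a fixed initial memory content, the t-th update (t = 0..n-1) maps
-- the current memory and the arriving symbol to the new memory, and the
-- output is a function of the final memory. (Update rules may depend on t,
-- i.e. the algorithm may be non-uniform; this only strengthens a lower bound.)
record StreamAlg (A : Set) (n s : ℕ) : Set where
  field
    init : Vec Bool s
    step : Fin n → Vec Bool s → A → Vec Bool s
    out  : Vec Bool s → ℕ

feed : {S : Set} (n : ℕ) → (Fin n → S → S) → S → S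
feed zero    f s = s
feed (suc n) f s = feed n (λ t → f (suc t)) (f zero s)

runAlg : {A : Set} {n s : ℕ} → StreamAlg A n s → Permutation′ n → (Fin n → A) → ℕ
runAlg {n = n} alg π x =
  StreamAlg.out alg (feed n (λ t st → StreamAlg.step alg t st (x (π ⟨$⟩ʳ t))) (StreamAlg.init alg))

ComputesLIS : (O : StrictTotalOrder 0ℓ 0ℓ 0ℓ) {n s : ℕ} →
              StreamAlg (StrictTotalOrder.Carrier O) n s → Permutation′ n → Set
ComputesLIS O alg π = ∀ x → IsLIS O x (runAlg alg π x)

{-# OPTIONS --safe #-}
-- Call Alice the positions read during the first h steps of the stream and Bob the others.
-- After h steps the algorithm knows Alice's symbols only through its s bits of memory, and the
-- output is a function of that memory and Bob's symbols. So it suffices to let Alice's symbols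
-- encode K bits b and Bob's an index j < K such that the LIS reveals b j (a reduction from
-- INDEX): distinct b must then leave distinct memories, hence 2^K ≤ 2^s. Cutting the positions
-- at index h = 3K ≤ n/2, either K of Alice's positions in the left part precede K of Bob's in the
-- right part, or K of Bob's precede K of Alice's. In the first case Alice writes 1 + 2r + b r on
-- her r-th position and Bob writes 2 + 2j + r on his r-th one, all other positions holding 0; an
-- increasing run through Alice's positions r ≤ j continues into all of Bob's exactly when
-- b j = 0, so the LIS is 2 + j + K − b j. The second case is the mirror image.

module Submission where

open import Defs
open import Level using (0ℓ)
open import Function using (_∘_)
open import Function.Bundles using (Inverse)
open import Data.Empty using (⊥; ⊥-elim)
open import Data.Bool using (Bool; true; false; _∧_; _∨_; not; if_then_else_; T)
open import Data.Bool.Properties using (∧-comm; ∧-zeroʳ)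
open import Data.Nat using (ℕ; zero; suc; _+_; _*_; _∸_; _⊓_; _^_; _≤_; _<_; z≤n; s≤s; s≤s⁻¹; z<s; _<ᵇ_; _<?_; _≤?_)
open import Data.Nat.Properties
open import Data.Nat.DivMod using (_/_; _%_; m≡m%n+[m/n]*n; m%n<n; m/n*n≤m; /-monoˡ-≤)
open import Data.Nat.Tactic.RingSolver using (solve-∀)
open import Data.Fin as F using (Fin; zero; suc; toℕ; fromℕ<; punchIn; funToFin; finToFun; combine)
import Data.Fin.Properties as F
open import Data.Fin.Permutation using (Permutation′; _⟨$⟩ʳ_; _⟨$⟩ˡ_; inverseˡ)
open import Data.Vec using (Vec; lookup; tabulate)
open import Data.Vec.Properties using (tabulate∘lookup; tabulate-cong)
open import Data.Product using (Σ; _×_; _,_; proj₁; proj₂; ∃-syntax)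
open import Data.Sum using (_⊎_; inj₁; inj₂; [_,_]′)
open import Relation.Binary using (tri<; tri≈; tri>; _Preserves_⟶_)
open import Relation.Binary.Bundles using (StrictTotalOrder)
open import Relation.Binary.PropositionalEquality
open import Relation.Nullary using (¬_; yes; no)
open import Relation.Nullary.Reflects using (ofʸ; ofⁿ)
open import Algebra.Properties.CommutativeSemigroup +-commutativeSemigroup using (interchange)
open import Algebra.Properties.CommutativeMonoid.Sum +-0-commutativeMonoid
  using (sum; sum-permute; sum-init-last; sum-cong-≗)

-- Counting

not≡true⇒≡false : ∀ {a} → not a ≡ true → a ≡ false
not≡true⇒≡false {false} _ = refl

∧-≡true : ∀ {a b} → (a ∧ b) ≡ true → a ≡ true × b ≡ true
∧-≡true {true} {true} _ = refl , refl

<⇒<ᵇ≡true : ∀ {m n} → m < n → (m <ᵇ n) ≡ true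
<⇒<ᵇ≡true {m} {n} m<n with m <ᵇ n | <ᵇ-reflects-< m n
... | true  | _       = refl
... | false | ofⁿ m≮n = ⊥-elim (m≮n m<n)

≥⇒<ᵇ≡false : ∀ {m n} → n ≤ m → (m <ᵇ n) ≡ false
≥⇒<ᵇ≡false {m} {n} n≤m with m <ᵇ n | <ᵇ-reflects-< m n
... | true  | ofʸ m<n = ⊥-elim (<⇒≱ m<n n≤m)
... | false | _       = refl

<ᵇ≡true⇒< : ∀ {m n} → (m <ᵇ n) ≡ true → m < n
<ᵇ≡true⇒< {m} {n} eq = <ᵇ⇒< m n (subst T (sym eq) _)

<ᵇ≡false⇒≥ : ∀ {m n} → (m <ᵇ n) ≡ false → n ≤ m
<ᵇ≡false⇒≥ {m} {n} eq = ≮⇒≥ (λ m<n → subst T eq (<⇒<ᵇ m<n))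

indicator : Bool → ℕ
indicator true  = 1
indicator false = 0

indicator≤1 : ∀ c → indicator c ≤ 1
indicator≤1 true  = ≤-refl
indicator≤1 false = z≤n

-- count P p is also the rank of a member p of P among the members of P.
count : (ℕ → Bool) → ℕ → ℕ
count P zero    = 0
count P (suc n) = count P n + indicator (P n)

count-cong : ∀ {P Q} n → (∀ p → p < n → P p ≡ Q p) → count P n ≡ count Q n
count-cong zero    eq = refl
count-cong (suc n) eq =
  cong₂ _+_ (count-cong n (λ p p<n → eq p (m<n⇒m<1+n p<n))) (cong indicator (eq n (n<1+n n)))

count-+ : ∀ {P Q R} n → (∀ p → indicator (P p) ≡ indicator (Q p) + indicator (R p)) →
          count P n ≡ count Q n + count R n
count-+ zero    eq = refl
count-+ {P} {Q} {R} (suc n) eq = begin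
  count P n + indicator (P n)
    ≡⟨ cong₂ _+_ (count-+ n eq) (eq n) ⟩
  (count Q n + count R n) + (indicator (Q n) + indicator (R n))
    ≡⟨ interchange (count Q n) (count R n) (indicator (Q n)) (indicator (R n)) ⟩
  count Q n + indicator (Q n) + (count R n + indicator (R n)) ∎
  where open ≡-Reasoning

count-∧-split : ∀ (P Q : ℕ → Bool) n → count P n ≡ count (λ p → P p ∧ Q p) n + count (λ p → P p ∧ not (Q p)) n
count-∧-split P Q n = count-+ {P} n λ p → split (P p) (Q p)
  where
  split : ∀ a b → indicator a ≡ indicator (a ∧ b) + indicator (a ∧ not b)
  split true  true  = refl
  split true  false = refl
  split false _     = refl

count-∨ : ∀ (P Q : ℕ → Bool) n → (∀ p → P p ≡ true → Q p ≡ true → ⊥) →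
          count (λ p → P p ∨ Q p) n ≡ count P n + count Q n
count-∨ P Q n disjoint = count-+ {λ p → P p ∨ Q p} n λ p → split p (P p) (Q p) refl refl
  where
  split : ∀ p a b → P p ≡ a → Q p ≡ b → indicator (a ∨ b) ≡ indicator a + indicator b
  split p true  true  Pp Qp with () ← disjoint p Pp Qp
  split p true  false _  _  = refl
  split p false _     _  _  = refl

count-≤ : ∀ {P Q} n → (∀ p → P p ≡ true → Q p ≡ true) → count P n ≤ count Q n
count-≤ zero    P⊆Q = z≤n
count-≤ {P} {Q} (suc n) P⊆Q = +-mono-≤ (count-≤ n P⊆Q) (indicator-mono (P⊆Q n))
  where
  indicator-mono : ∀ {a b} → (a ≡ true → b ≡ true) → indicator a ≤ indicator b
  indicator-mono {false}         _   = z≤n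
  indicator-mono {true}  {true}  _   = ≤-refl
  indicator-mono {true}  {false} a⇒b with () ← a⇒b refl

⊆-false : ∀ {P Q : ℕ → Bool} → (∀ {p} → P p ≡ true → Q p ≡ true) → ∀ p → Q p ≡ false → P p ≡ false
⊆-false {P} P⊆Q p Qp with P p in Pp
... | true  with () ← trans (sym Qp) (P⊆Q Pp)
... | false = refl

count-monoʳ : ∀ P {m n} → m ≤ n → count P m ≤ count P n
count-monoʳ P {m} {n} m≤n with m≤n⇒∃[o]m+o≡n m≤n
... | d , refl = go m d
  where
  go : ∀ m d → count P m ≤ count P (m + d)
  go m zero    rewrite +-identityʳ m = ≤-refl
  go m (suc d) rewrite +-suc m d     = ≤-trans (go m d) (m≤m+n _ _)

count-<-member : ∀ P {p q} → P p ≡ true → p < q → count P p < count P q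
count-<-member P {p} {q} Pp p<q = begin-strict
  count P p                   <⟨ n<1+n _ ⟩
  suc (count P p)             ≡⟨ +-comm 1 (count P p) ⟩
  count P p + indicator true  ≡⟨ cong (λ b → count P p + indicator b) Pp ⟨
  count P (suc p)             ≤⟨ count-monoʳ P p<q ⟩
  count P q                   ∎
  where open ≤-Reasoning

count-<ᵇ : ∀ b n → count (_<ᵇ b) n ≡ b ⊓ n
count-<ᵇ b zero = sym (⊓-zeroʳ b)
count-<ᵇ b (suc n) with n <ᵇ b | <ᵇ-reflects-< n b
... | true  | ofʸ n<b rewrite count-<ᵇ b n | m≥n⇒m⊓n≡n (<⇒≤ n<b) | m≥n⇒m⊓n≡n n<b = +-comm n 1
... | false | ofⁿ n≮b rewrite count-<ᵇ b n | m≤n⇒m⊓n≡m (≮⇒≥ n≮b) | m≤n⇒m⊓n≡m (m≤n⇒m≤1+n (≮⇒≥ n≮b)) = +-identityʳ b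

count-true : ∀ n → count (λ _ → true) n ≡ n
count-true zero    = refl
count-true (suc n) = trans (cong (_+ 1) (count-true n)) (+-comm n 1)

count-suc : ∀ P n → count P (suc n) ≡ indicator (P 0) + count (λ p → P (suc p)) n
count-suc P zero    = +-comm 0 (indicator (P 0))
count-suc P (suc n) = begin
  count P (suc n) + indicator (P (suc n))
    ≡⟨ cong (_+ indicator (P (suc n))) (count-suc P n) ⟩
  indicator (P 0) + count (λ p → P (suc p)) n + indicator (P (suc n))
    ≡⟨ +-assoc (indicator (P 0)) _ _ ⟩
  indicator (P 0) + count (λ p → P (suc p)) (suc n) ∎
  where open ≡-Reasoning

take : ℕ → (ℕ → Bool) → ℕ → Bool
take m P p = P p ∧ (count P p <ᵇ m)

count-take : ∀ m P n → count (take m P) n ≡ m ⊓ count P n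
count-take m P zero = sym (⊓-zeroʳ m)
count-take m P (suc n) with P n
... | false rewrite count-take m P n | +-identityʳ (count P n) = +-identityʳ _
... | true with count P n <ᵇ m | <ᵇ-reflects-< (count P n) m
...   | true  | ofʸ c<m rewrite count-take m P n | m≥n⇒m⊓n≡n (<⇒≤ c<m)
                              | m≥n⇒m⊓n≡n (subst (_≤ m) (+-comm 1 (count P n)) c<m) = refl
...   | false | ofⁿ c≮m rewrite count-take m P n | m≤n⇒m⊓n≡m (≮⇒≥ c≮m)
                              | m≤n⇒m⊓n≡m (≤-trans (≮⇒≥ c≮m) (m≤m+n (count P n) 1)) = +-identityʳ m

take-⊆ : ∀ m P {p} → take m P p ≡ true → P p ≡ true
take-⊆ m P = proj₁ ∘ ∧-≡true

take-< : ∀ m P {p} → take m P p ≡ true → count P p < m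
take-< m P = <ᵇ≡true⇒< ∘ proj₂ ∘ ∧-≡true

take-rank : ∀ m P {p} → take m P p ≡ true → count (take m P) p < m
take-rank m P {p} Pp = begin-strict
  count (take m P) p  ≡⟨ count-take m P p ⟩
  m ⊓ count P p       ≤⟨ m⊓n≤n m _ ⟩
  count P p           <⟨ take-< m P Pp ⟩
  m                   ∎
  where open ≤-Reasoning

drop : ℕ → (ℕ → Bool) → ℕ → Bool
drop m P p = P p ∧ not (count P p <ᵇ m)

drop-⊆ : ∀ m P {p} → drop m P p ≡ true → P p ≡ true
drop-⊆ m P = proj₁ ∘ ∧-≡true

drop-≥ : ∀ m P {p} → drop m P p ≡ true → m ≤ count P p
drop-≥ m P = <ᵇ≡false⇒≥ ∘ not≡true⇒≡false ∘ proj₂ ∘ ∧-≡true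

count-drop : ∀ m P n → m ≤ count P n → count (drop m P) n ≡ count P n ∸ m
count-drop m P n m≤ = begin
  count (drop m P) n                           ≡⟨ m+n∸m≡n m _ ⟨
  m + count (drop m P) n ∸ m                   ≡⟨ cong (λ k → k + count (drop m P) n ∸ m) count-take-m ⟨
  count (take m P) n + count (drop m P) n ∸ m  ≡⟨ cong (_∸ m) (count-∧-split P (λ p → count P p <ᵇ m) n) ⟨
  count P n ∸ m                                ∎
  where
  open ≡-Reasoning
  count-take-m : count (take m P) n ≡ m
  count-take-m = trans (count-take m P n) (m≤n⇒m⊓n≡m m≤)

count-sum : ∀ P n → count P n ≡ sum {n} (λ i → indicator (P (toℕ i)))
count-sum P zero    = refl
count-sum P (suc n) = begin
  count P n + indicator (P n)
    ≡⟨ cong₂ _+_ (trans (count-sum P n) (sum-cong-≗ {n} λ i → cong (indicator ∘ P) (sym (F.toℕ-inject₁ i))))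
                 (cong (indicator ∘ P) (sym (F.toℕ-fromℕ n))) ⟩
  sum {n} (λ i → indicator (P (toℕ (F.inject₁ i)))) + indicator (P (toℕ (F.fromℕ n)))
    ≡⟨ sum-init-last {n} (λ i → indicator (P (toℕ i))) ⟨
  sum {suc n} (λ i → indicator (P (toℕ i))) ∎
  where open ≡-Reasoning

count-permute : ∀ {n} P Q (π : Permutation′ n) → (∀ t → P (toℕ (π ⟨$⟩ʳ t)) ≡ Q (toℕ t)) → count P n ≡ count Q n
count-permute {n} P Q π P∘π≡Q = begin
  count P n                                       ≡⟨ count-sum P n ⟩
  sum {n} (λ i → indicator (P (toℕ i)))             ≡⟨ sum-permute (λ i → indicator (P (toℕ i))) π ⟩
  sum {n} (λ t → indicator (P (toℕ (π ⟨$⟩ʳ t))))    ≡⟨ sum-cong-≗ {n} (cong indicator ∘ P∘π≡Q) ⟩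
  sum {n} (λ t → indicator (Q (toℕ t)))             ≡⟨ count-sum Q n ⟨
  count Q n ∎
  where open ≡-Reasoning

-- Increasing subsequences

ℕₛ : StrictTotalOrder 0ℓ 0ℓ 0ℓ
ℕₛ = <-strictTotalOrder

strictMono⇒≤ : ∀ {k B} (g : Fin k → ℕ) → (∀ i j → i F.< j → g i < g j) → (∀ i → g i < B) → k ≤ B
strictMono⇒≤ {k} {B} g mono bounded = F.injective⇒≤ {f = λ i → fromℕ< (bounded i)} injective
  where
  injective : ∀ {i j} → fromℕ< (bounded i) ≡ fromℕ< (bounded j) → i ≡ j
  injective {i} {j} eq with F.<-cmp i j | trans (sym (F.toℕ-fromℕ< _)) (trans (cong toℕ eq) (F.toℕ-fromℕ< _))
  ... | tri< i<j _ _ | gi≡gj = ⊥-elim (<-irrefl gi≡gj (mono i j i<j))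
  ... | tri≈ _ i≡j _ | _     = i≡j
  ... | tri> _ _ j<i | gi≡gj = ⊥-elim (<-irrefl (sym gi≡gj) (mono j i j<i))

module _ (O : StrictTotalOrder 0ℓ 0ℓ 0ℓ) where
  open StrictTotalOrder O renaming (Carrier to A; _<_ to _⊏_)

  IncSubseq-tail : ∀ {n k} {x : Fin (suc n) → A} → IncSubseq O (λ p → x (suc p)) k → IncSubseq O x k
  IncSubseq-tail (f , f-mono , x-mono) = (λ i → suc (f i)) , (λ i j i<j → s≤s (f-mono i j i<j)) , x-mono

  IncSubseq-cons : ∀ {n k} {x : Fin (suc n) → A} (s : IncSubseq O (λ p → x (suc p)) k) →
                   (∀ i → x zero ⊏ x (suc (proj₁ s i))) → IncSubseq O x (suc k)
  IncSubseq-cons {x = x} (f , f-mono , x-mono) head< = g , g-mono , xg-mono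
    where
    g : Fin (suc _) → Fin (suc _)
    g zero    = zero
    g (suc i) = suc (f i)
    g-mono : ∀ i j → i F.< j → g i F.< g j
    g-mono zero    (suc j) _         = s≤s z≤n
    g-mono (suc i) (suc j) (s≤s i<j) = s≤s (f-mono i j i<j)
    xg-mono : ∀ i j → i F.< j → x (g i) ⊏ x (g j)
    xg-mono zero    (suc j) _         = head< j
    xg-mono (suc i) (suc j) (s≤s i<j) = x-mono i j i<j

  potential-bound : ∀ {n k B} (x : Fin n → A) (φ : Fin n → ℕ) →
                    (∀ p q → p F.< q → x p ⊏ x q → φ p < φ q) → (∀ p → φ p < B) →
                    IncSubseq O x k → k ≤ B
  potential-bound x φ φ-mono φ<B (f , f-mono , x-mono) =
    strictMono⇒≤ (λ i → φ (f i)) (λ i j i<j → φ-mono _ _ (f-mono i j i<j) (x-mono i j i<j)) (λ i → φ<B (f i))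

IncSubseq-map : ∀ (O O′ : StrictTotalOrder 0ℓ 0ℓ 0ℓ) {n k} {x : Fin n → StrictTotalOrder.Carrier O}
                {y : Fin n → StrictTotalOrder.Carrier O′} →
                (∀ p q → StrictTotalOrder._<_ O (x p) (x q) → StrictTotalOrder._<_ O′ (y p) (y q)) →
                IncSubseq O x k → IncSubseq O′ y k
IncSubseq-map O O′ x⇒y (f , f-mono , x-mono) = f , f-mono , λ i j i<j → x⇒y _ _ (x-mono i j i<j)

chain⇒IncSubseq : ∀ n (Q : ℕ → Bool) (v : ℕ → ℕ) →
        (∀ {p q} → p < q → q < n → Q p ≡ true → Q q ≡ true → v p < v q) →
        Σ (IncSubseq ℕₛ (λ (p : Fin n) → v (toℕ p)) (count Q n)) λ s → ∀ i → Q (toℕ (proj₁ s i)) ≡ true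
chain⇒IncSubseq zero    Q v mono = ((λ ()) , (λ ()) , (λ ())) , (λ ())
chain⇒IncSubseq (suc n) Q v mono
  rewrite count-suc Q n
  with chain⇒IncSubseq n (λ p → Q (suc p)) (λ p → v (suc p)) (λ p<q q<n → mono (s≤s p<q) (s≤s q<n)) | Q 0 in Q0
... | rest , members | false = IncSubseq-tail ℕₛ {x = λ p → v (toℕ p)} rest , members
... | rest , members | true  = IncSubseq-cons ℕₛ {x = λ p → v (toℕ p)} rest head< , members′
  where
  head< : ∀ i → v 0 < v (suc (toℕ (proj₁ rest i)))
  head< i = mono z<s (s≤s (F.toℕ<n _)) Q0 (members i)
  members′ : ∀ i → Q (toℕ (proj₁ (IncSubseq-cons ℕₛ {x = λ p → v (toℕ p)} rest head<) i)) ≡ true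
  members′ zero    = Q0
  members′ (suc i) = members i

-- Letters

module _ (O : StrictTotalOrder 0ℓ 0ℓ 0ℓ) where
  open StrictTotalOrder O renaming (Carrier to A; _<_ to _⊏_; trans to ⊏-trans)

  minimum : ∀ {m} (f : Fin (suc m) → A) → Σ (Fin (suc m)) λ k → ∀ i → ¬ (f i ⊏ f k)
  minimum {zero}  f = zero , λ { zero → irrefl Eq.refl }
  minimum {suc m} f with minimum (f ∘ suc)
  ... | k , k-min with compare (f zero) (f (suc k))
  ... | tri< f0<fk _ _ = zero , λ { zero → irrefl Eq.refl ; (suc i) fi<f0 → k-min i (⊏-trans fi<f0 f0<fk) }
  ... | tri≈ _ f0≈fk _ = suc k , λ { zero → irrefl f0≈fk ; (suc i) → k-min i }
  ... | tri> _ _ fk<f0 = suc k , λ { zero f0<fk → asym f0<fk fk<f0 ; (suc i) → k-min i }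

  sort : ∀ m (f : Fin (suc m) → A) → (∀ i j → f i ≈ f j → i ≡ j) →
         Σ (Fin (suc m) → A) λ g → (∀ i j → i F.< j → g i ⊏ g j) × (∀ i → Σ (Fin (suc m)) λ k → g i ≡ f k)
  sort zero    f f-inj = f , (λ { zero zero () }) , (λ i → i , refl)
  sort (suc m) f f-inj with minimum f
  ... | k , k-min with sort m (f ∘ punchIn k) (λ i j eq → F.punchIn-injective k i j (f-inj _ _ eq))
  ... | g′ , g′-mono , g′-range = g , g-mono , g-range
    where
    k-least : ∀ i → i ≢ k → f k ⊏ f i
    k-least i i≢k with compare (f k) (f i)
    ... | tri< fk<fi _ _ = fk<fi
    ... | tri≈ _ fk≈fi _ = ⊥-elim (i≢k (sym (f-inj _ _ fk≈fi)))
    ... | tri> _ _ fi<fk = ⊥-elim (k-min i fi<fk)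
    g : Fin (suc (suc m)) → A
    g zero    = f k
    g (suc i) = g′ i
    g-mono : ∀ i j → i F.< j → g i ⊏ g j
    g-mono zero    (suc j) _ with g′-range j
    ... | l , g′j≡ = subst (f k ⊏_) (sym g′j≡) (k-least (punchIn k l) (F.punchInᵢ≢i k l))
    g-mono (suc i) (suc j) (s≤s i<j) = g′-mono i j i<j
    g-range : ∀ i → Σ (Fin (suc (suc m))) λ l → g i ≡ f l
    g-range zero    = k , refl
    g-range (suc i) with g′-range i
    ... | l , g′i≡ = punchIn k l , g′i≡

  increasing-letters : ∀ {n} → CardGt O n → Σ (Fin (suc n) → A) λ g → ∀ i j → i F.< j → g i ⊏ g j
  increasing-letters {n} (f , f-inj) with sort n f f-inj
  ... | g , g-mono , _ = g , g-mono

  module Letters {n : ℕ} (g : Fin (suc n) → A) (g-mono : ∀ i j → i F.< j → g i ⊏ g j) where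

    -- Values above n are clamped to the largest letter.
    letter : ℕ → A
    letter a = g (fromℕ< (s≤s (m⊓n≤n a n)))

    private
      clamp-≤ : ∀ {a} → a ≤ n → toℕ (fromℕ< (s≤s (m⊓n≤n a n))) ≡ a
      clamp-≤ a≤n = trans (F.toℕ-fromℕ< _) (m≤n⇒m⊓n≡m a≤n)

    letter-mono : ∀ {a b} → a ≤ n → b ≤ n → a < b → letter a ⊏ letter b
    letter-mono a≤n b≤n a<b = g-mono _ _ (subst₂ _<_ (sym (clamp-≤ a≤n)) (sym (clamp-≤ b≤n)) a<b)

    letter-reflect : ∀ {a b} → a ≤ n → b ≤ n → letter a ⊏ letter b → a < b
    letter-reflect a≤n b≤n la<lb = subst₂ _<_ (clamp-≤ a≤n) (clamp-≤ b≤n) (g-reflect _ _ la<lb)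
      where
      g-reflect : ∀ i j → g i ⊏ g j → i F.< j
      g-reflect i j gi<gj with F.<-cmp i j
      ... | tri< i<j _ _ = i<j
      ... | tri≈ _ refl _ = ⊥-elim (irrefl Eq.refl gi<gj)
      ... | tri> _ _ j<i = ⊥-elim (asym gi<gj (g-mono j i j<i))

    IncSubseq-letter : ∀ {m k} (v : Fin m → ℕ) → (∀ p → v p ≤ n) →
                       IncSubseq ℕₛ v k → IncSubseq O (letter ∘ v) k
    IncSubseq-letter v v≤n = IncSubseq-map ℕₛ O (λ p q → letter-mono (v≤n p) (v≤n q))

    IncSubseq-unletter : ∀ {m k} (v : Fin m → ℕ) → (∀ p → v p ≤ n) →
                         IncSubseq O (letter ∘ v) k → IncSubseq ℕₛ v k
    IncSubseq-unletter v v≤n = IncSubseq-map O ℕₛ (λ p q → letter-reflect (v≤n p) (v≤n q))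

-- Streaming and fooling sets

feedFirst : ∀ {S : Set} n → ℕ → (Fin n → S → S) → S → S
feedFirst n       zero    f s = s
feedFirst zero    (suc h) f s = s
feedFirst (suc n) (suc h) f s = feedFirst n h (f ∘ suc) (f zero s)

feedFirst-cong : ∀ {S : Set} n h (f g : Fin n → S → S) s →
                 (∀ t st → toℕ t < h → f t st ≡ g t st) → feedFirst n h f s ≡ feedFirst n h g s
feedFirst-cong n       zero    f g s eq = refl
feedFirst-cong zero    (suc h) f g s eq = refl
feedFirst-cong (suc n) (suc h) f g s eq =
  trans (cong (feedFirst n h (f ∘ suc)) (eq zero s z<s))
        (feedFirst-cong n h (f ∘ suc) (g ∘ suc) _ (λ t st t<h → eq (suc t) st (s≤s t<h)))

feed-cong : ∀ {S : Set} n (f g : Fin n → S → S) s → (∀ t st → f t st ≡ g t st) → feed n f s ≡ feed n g s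
feed-cong zero    f g s eq = refl
feed-cong (suc n) f g s eq =
  trans (cong (feed n (f ∘ suc)) (eq zero s)) (feed-cong n (f ∘ suc) (g ∘ suc) _ (eq ∘ suc))

feed-cong-after : ∀ {S : Set} n h (f g : Fin n → S → S) s s′ → feedFirst n h f s ≡ feedFirst n h g s′ →
                  (∀ t st → h ≤ toℕ t → f t st ≡ g t st) → feed n f s ≡ feed n g s′
feed-cong-after n       zero    f g s s′ refl eq = feed-cong n f g s (λ t st → eq t st z≤n)
feed-cong-after zero    (suc h) f g s s′ eq₀  eq = eq₀
feed-cong-after (suc n) (suc h) f g s s′ eq₀  eq =
  feed-cong-after n h (f ∘ suc) (g ∘ suc) _ _ eq₀ (λ t st h≤t → eq (suc t) st (s≤s h≤t))

funToFin-cong : ∀ {m k} {f g : Fin m → Fin k} → (∀ i → f i ≡ g i) → funToFin f ≡ funToFin g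
funToFin-cong {zero}  eq = refl
funToFin-cong {suc m} eq = cong₂ combine (eq zero) (funToFin-cong (eq ∘ suc))

module _ where
  open Inverse F.2↔Bool using (to; from; strictlyInverseʳ; strictlyInverseˡ)

  encode : ∀ {s} → Vec Bool s → Fin (2 ^ s)
  encode v = funToFin (from ∘ lookup v)

  encode-injective : ∀ {s} (u v : Vec Bool s) → encode u ≡ encode v → u ≡ v
  encode-injective u v eq = begin
    u                    ≡⟨ tabulate∘lookup u ⟨
    tabulate (lookup u)  ≡⟨ tabulate-cong lookup-eq ⟩
    tabulate (lookup v)  ≡⟨ tabulate∘lookup v ⟩
    v                    ∎
    where
    open ≡-Reasoning
    lookup-eq : ∀ i → lookup u i ≡ lookup v i
    lookup-eq i = begin
      lookup u i                  ≡⟨ strictlyInverseˡ _ ⟨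
      to (from (lookup u i))      ≡⟨ cong to (F.finToFun-funToFin (from ∘ lookup u) i) ⟨
      to (finToFun (encode u) i)  ≡⟨ cong (λ e → to (finToFun e i)) eq ⟩
      to (finToFun (encode v) i)  ≡⟨ cong to (F.finToFun-funToFin (from ∘ lookup v) i) ⟩
      to (from (lookup v i))      ≡⟨ strictlyInverseˡ _ ⟩
      lookup v i                  ∎

  decode : ∀ K → Fin (2 ^ K) → ℕ → Bool
  decode K e r with r <? K
  ... | yes r<K = to (finToFun e (fromℕ< r<K))
  ... | no  _   = false

  decode-injective : ∀ K (e e′ : Fin (2 ^ K)) → (∀ j → j < K → decode K e j ≡ decode K e′ j) → e ≡ e′
  decode-injective K e e′ eq = begin
    e                               ≡⟨ F.funToFin-finToFin {K} {2} e ⟨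
    funToFin (finToFun {2} {K} e)   ≡⟨ funToFin-cong pointwise ⟩
    funToFin (finToFun {2} {K} e′)  ≡⟨ F.funToFin-finToFin {K} {2} e′ ⟩
    e′                              ∎
    where
    open ≡-Reasoning
    decode-at : ∀ (e : Fin (2 ^ K)) i → decode K e (toℕ i) ≡ to (finToFun e i)
    decode-at e i with toℕ i <? K
    ... | yes i<K = cong (to ∘ finToFun e) (F.fromℕ<-toℕ i i<K)
    ... | no  i≮K = ⊥-elim (i≮K (F.toℕ<n i))
    pointwise : ∀ i → finToFun e i ≡ finToFun e′ i
    pointwise i = begin
      finToFun e i               ≡⟨ strictlyInverseʳ _ ⟨
      from (to (finToFun e i))   ≡⟨ cong from (decode-at e i) ⟨
      from (decode K e (toℕ i))  ≡⟨ cong from (eq (toℕ i) (F.toℕ<n i)) ⟩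
      from (decode K e′ (toℕ i)) ≡⟨ cong from (decode-at e′ i) ⟩
      from (to (finToFun e′ i))  ≡⟨ strictlyInverseʳ _ ⟩
      finToFun e′ i              ∎

separating⇒≤ : ∀ {K s} (m : (ℕ → Bool) → Vec Bool s) →
               (∀ b b′ → m b ≡ m b′ → ∀ j → j < K → b j ≡ b′ j) → K ≤ s
separating⇒≤ {K} {s} m separates = ≮⇒≥ λ s<K → <⇒≱ (^-monoʳ-< 2 (s≤s (s≤s z≤n)) s<K) 2^K≤2^s
  where
  2^K≤2^s : 2 ^ K ≤ 2 ^ s
  2^K≤2^s = F.injective⇒≤ {f = encode ∘ m ∘ decode K} λ {e} {e′} eq →
    decode-injective K e e′ (separates (decode K e) (decode K e′) (encode-injective _ _ eq))

module Stream {A : Set} {n s : ℕ} (alg : StreamAlg A n s) (π : Permutation′ n) (h : ℕ) where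
  open StreamAlg alg

  update : (Fin n → A) → Fin n → Vec Bool s → Vec Bool s
  update x t st = step t st (x (π ⟨$⟩ʳ t))

  memory : (Fin n → A) → Vec Bool s
  memory x = feedFirst n h (update x) init

  memory-cong : ∀ {x y} → (∀ t → toℕ t < h → x (π ⟨$⟩ʳ t) ≡ y (π ⟨$⟩ʳ t)) → memory x ≡ memory y
  memory-cong eq = feedFirst-cong n h _ _ init (λ t st t<h → cong (step t st) (eq t t<h))

  runAlg-cong : ∀ {x y} → memory x ≡ memory y → (∀ t → h ≤ toℕ t → x (π ⟨$⟩ʳ t) ≡ y (π ⟨$⟩ʳ t)) →
                runAlg alg π x ≡ runAlg alg π y
  runAlg-cong mem-eq eq =
    cong out (feed-cong-after n h _ _ init init mem-eq (λ t st h≤t → cong (step t st) (eq t h≤t)))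

  fooling-bound : ∀ K (w : (ℕ → Bool) → ℕ → Fin n → A) →
                  (∀ b j j′ t → toℕ t < h → w b j (π ⟨$⟩ʳ t) ≡ w b j′ (π ⟨$⟩ʳ t)) →
                  (∀ b b′ j t → h ≤ toℕ t → w b j (π ⟨$⟩ʳ t) ≡ w b′ j (π ⟨$⟩ʳ t)) →
                  (∀ b b′ j → j < K → b j ≡ false → b′ j ≡ true →
                     runAlg alg π (w b j) ≢ runAlg alg π (w b′ j)) →
                  K ≤ s
  fooling-bound K w prefix suffix distinguish = separating⇒≤ (λ b → memory (w b 0)) separates
    where
    same-output : ∀ b b′ j → memory (w b 0) ≡ memory (w b′ 0) → runAlg alg π (w b j) ≡ runAlg alg π (w b′ j)
    same-output b b′ j mem = runAlg-cong {w b j} {w b′ j}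
      (trans (memory-cong {w b j} {w b 0} (prefix b j 0))
             (trans mem (memory-cong {w b′ 0} {w b′ j} (prefix b′ 0 j))))
      (suffix b b′ j)
    separates : ∀ b b′ → memory (w b 0) ≡ memory (w b′ 0) → ∀ j → j < K → b j ≡ b′ j
    separates b b′ mem j j<K with b j in bj | b′ j in b′j
    ... | false | false = refl
    ... | true  | true  = refl
    ... | false | true  = ⊥-elim (distinguish b b′ j j<K bj b′j (same-output b b′ j mem))
    ... | true  | false = ⊥-elim (distinguish b′ b j j<K b′j bj (same-output b′ b j (sym mem)))

-- Two-block inputs

module TwoBlocks (E L : ℕ → Bool) (K : ℕ)
  (E-before-L : ∀ {p q} → E p ≡ true → L q ≡ true → p < q)
  (E-rank : ∀ {p} → E p ≡ true → count E p < K)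
  (L-rank : ∀ {p} → L p ≡ true → count L p < K) where

  word : (α β : ℕ → ℕ) → ℕ → ℕ
  word α β p = if E p then α (count E p) else if L p then β (count L p) else 0

  data Block (p : ℕ) : Set where
    inE     : E p ≡ true → Block p
    inL     : L p ≡ true → Block p
    outside : E p ≡ false → L p ≡ false → Block p

  block : ∀ p → Block p
  block p with E p in Ep | L p in Lp
  ... | true  | _     = inE Ep
  ... | false | true  = inL Lp
  ... | false | false = outside Ep Lp

  value : (α β : ℕ → ℕ) → ∀ {p} → Block p → ℕ
  value α β {p} (inE _)       = α (count E p)
  value α β {p} (inL _)       = β (count L p)
  value α β     (outside _ _) = 0

  word≡value : ∀ α β {p} (b : Block p) → word α β p ≡ value α β b
  word≡value α β {p} (inE Ep) = cong (if_then α (count E p) else _) Ep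
  word≡value α β {p} (inL Lp) with E p in Ep
  ... | true  = ⊥-elim (<-irrefl refl (E-before-L Ep Lp))
  ... | false = cong (if_then β (count L p) else 0) Lp
  word≡value α β {p} (outside Ep Lp) =
    trans (cong (if_then α (count E p) else _) Ep) (cong (if_then β (count L p) else 0) Lp)

  value<⇒word< : ∀ α β {p q} (bp : Block p) (bq : Block q) → value α β bp < value α β bq → word α β p < word α β q
  value<⇒word< α β bp bq = subst₂ _<_ (sym (word≡value α β bp)) (sym (word≡value α β bq))

  word-cong-early : ∀ α α′ β {p} → E p ≡ false → word α β p ≡ word α′ β p
  word-cong-early α α′ β {p} Ep with block p
  ... | inE Ep′           with () ← trans (sym Ep) Ep′
  ... | b@(inL _)         = trans (word≡value α β b) (sym (word≡value α′ β b))
  ... | b@(outside _ _)   = trans (word≡value α β b) (sym (word≡value α′ β b))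

  word-cong-late : ∀ α β β′ {p} → L p ≡ false → word α β p ≡ word α β′ p
  word-cong-late α β β′ {p} Lp with block p
  ... | b@(inE _)         = trans (word≡value α β b) (sym (word≡value α β′ b))
  ... | inL Lp′           with () ← trans (sym Lp) Lp′
  ... | b@(outside _ _)   = trans (word≡value α β b) (sym (word≡value α β′ b))

  word-< : ∀ {α β B} → 0 < B → (∀ r → r < K → α r < B) → (∀ r → r < K → β r < B) → ∀ p → word α β p < B
  word-< {α} {β} {B} 0<B α<B β<B p = subst (_< B) (sym (word≡value α β (block p))) (value-< (block p))
    where
    value-< : (b : Block p) → value α β b < B
    value-< (inE Ep)      = α<B _ (E-rank Ep)
    value-< (inL Lp)      = β<B _ (L-rank Lp)
    value-< (outside _ _) = 0<B

  word-potential : ∀ {α β φ ψ} → φ Preserves _<_ ⟶ _<_ → ψ Preserves _<_ ⟶ _<_ →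
                   (∀ r r′ → r < K → r′ < K → α r < β r′ → φ r < ψ r′) →
                   (∀ r → 0 < φ r) → (∀ r → 0 < ψ r) →
                   ∀ {p q} → p < q → word α β p < word α β q → word φ ψ p < word φ ψ q
  word-potential {α} {β} {φ} {ψ} φ-mono ψ-mono αβ⇒φψ φ>0 ψ>0 {p} {q} p<q w<w =
    value<⇒word< φ ψ (block p) (block q)
      (potential (block p) (block q) (subst₂ _<_ (word≡value α β (block p)) (word≡value α β (block q)) w<w))
    where
    potential : (bp : Block p) (bq : Block q) → value α β bp < value α β bq → value φ ψ bp < value φ ψ bq
    potential (inE Ep)      (inE _)       _   = φ-mono (count-<-member E Ep p<q)
    potential (inE Ep)      (inL Lq)      v<v = αβ⇒φψ _ _ (E-rank Ep) (L-rank Lq) v<v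
    potential (inL Lp)      (inE Eq)      _   = ⊥-elim (<-asym p<q (E-before-L Eq Lp))
    potential (inL Lp)      (inL _)       _   = ψ-mono (count-<-member L Lp p<q)
    potential (outside _ _) (inE _)       _   = φ>0 _
    potential (outside _ _) (inL _)       _   = ψ>0 _
    potential _             (outside _ _) v<0 = ⊥-elim (n≮0 v<0)

  word-chain : ∀ {α β} n (E′ L′ : ℕ → Bool) → 0 < n → E 0 ≡ false → L 0 ≡ false →
               (∀ {p} → E′ p ≡ true → E p ≡ true) → (∀ {p} → L′ p ≡ true → L p ≡ true) →
               α Preserves _<_ ⟶ _<_ → β Preserves _<_ ⟶ _<_ →
               (∀ {p q} → E′ p ≡ true → L′ q ≡ true → α (count E p) < β (count L q)) →
               (∀ r → 0 < α r) → (∀ r → 0 < β r) →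
               IncSubseq ℕₛ (λ (p : Fin n) → word α β (toℕ p)) (suc (count E′ n + count L′ n))
  word-chain {α} {β} n E′ L′ 0<n E0 L0 E′⊆E L′⊆L α-mono β-mono E′<L′ α>0 β>0 =
    subst (IncSubseq ℕₛ (λ (p : Fin n) → word α β (toℕ p))) length
          (proj₁ (chain⇒IncSubseq n Q (word α β) Q-increasing))
    where
    Q : ℕ → Bool
    Q p = (p <ᵇ 1) ∨ (E′ p ∨ L′ p)

    data Member (p : ℕ) : Set where
      origin : p ≡ 0 → Member p
      inE′   : E′ p ≡ true → Member p
      inL′   : L′ p ≡ true → Member p

    member : ∀ p → Q p ≡ true → Member p
    member zero    _  = origin refl
    member (suc p) Qp with E′ (suc p) in E′p | L′ (suc p) in L′p
    ... | true  | _     = inE′ E′p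
    ... | false | true  = inL′ L′p

    E′L′0 : (E′ 0 ∨ L′ 0) ≡ false
    E′L′0 = cong₂ _∨_ (⊆-false {E′} E′⊆E 0 E0) (⊆-false {L′} L′⊆L 0 L0)

    length : count Q n ≡ suc (count E′ n + count L′ n)
    length = begin
      count Q n                                     ≡⟨ count-∨ (_<ᵇ 1) _ n origin-only ⟩
      count (_<ᵇ 1) n + count (λ p → E′ p ∨ L′ p) n  ≡⟨ cong₂ _+_ (trans (count-<ᵇ 1 n) (m≤n⇒m⊓n≡m 0<n))
                                                                  (count-∨ E′ L′ n E′L′-disjoint) ⟩
      suc (count E′ n + count L′ n)                 ∎
      where
      open ≡-Reasoning
      origin-only : ∀ p → (p <ᵇ 1) ≡ true → (E′ p ∨ L′ p) ≡ true → ⊥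
      origin-only zero _ E′L′p with () ← trans (sym E′L′0) E′L′p
      E′L′-disjoint : ∀ p → E′ p ≡ true → L′ p ≡ true → ⊥
      E′L′-disjoint p E′p L′p = <-irrefl refl (E-before-L (E′⊆E E′p) (L′⊆L L′p))

    block-of : ∀ {p} → Member p → Block p
    block-of (origin refl) = outside E0 L0
    block-of (inE′ E′p)    = inE (E′⊆E E′p)
    block-of (inL′ L′p)    = inL (L′⊆L L′p)

    increasing : ∀ {p q} → p < q → (mp : Member p) (mq : Member q) →
                 value α β (block-of mp) < value α β (block-of mq)
    increasing p<q _             (origin refl) = ⊥-elim (n≮0 p<q)
    increasing p<q (origin refl) (inE′ _)      = α>0 _
    increasing p<q (origin refl) (inL′ _)      = β>0 _
    increasing p<q (inE′ E′p)    (inE′ _)      = α-mono (count-<-member E (E′⊆E E′p) p<q)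
    increasing p<q (inE′ E′p)    (inL′ L′q)    = E′<L′ E′p L′q
    increasing p<q (inL′ L′p)    (inE′ E′q)    = ⊥-elim (<-asym p<q (E-before-L (E′⊆E E′q) (L′⊆L L′p)))
    increasing p<q (inL′ L′p)    (inL′ _)      = β-mono (count-<-member L (L′⊆L L′p) p<q)

    Q-increasing : ∀ {p q} → p < q → q < n → Q p ≡ true → Q q ≡ true → word α β p < word α β q
    Q-increasing {p} {q} p<q _ Qp Qq =
      value<⇒word< α β (block-of (member p Qp)) (block-of (member q Qq))
                       (increasing p<q (member p Qp) (member q Qq))

-- Values encoding bits and queries

double+bit-mono : ∀ {r r′} c c′ → r < r′ → r + r + indicator c < r′ + r′ + indicator c′
double+bit-mono {r} {r′} c c′ r<r′ = begin-strict
  r + r + indicator c     ≤⟨ +-monoʳ-≤ (r + r) (indicator≤1 c) ⟩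
  r + r + 1               ≡⟨ +-comm (r + r) 1 ⟩
  suc (r + r)             <⟨ n<1+n _ ⟩
  suc (suc (r + r))       ≡⟨ cong suc (+-suc r r) ⟨
  suc r + suc r           ≤⟨ +-mono-≤ r<r′ r<r′ ⟩
  r′ + r′                 ≤⟨ m≤m+n (r′ + r′) _ ⟩
  r′ + r′ + indicator c′  ∎
  where open ≤-Reasoning

double+bit-below : ∀ {r j} c → r ≤ j → (r ≡ j → c ≡ false) → r + r + indicator c ≤ r + j
double+bit-below {r} {j} c r≤j c-at-j with m≤n⇒m<n∨m≡n r≤j
... | inj₁ r<j = begin
  r + r + indicator c  ≤⟨ +-monoʳ-≤ (r + r) (indicator≤1 c) ⟩
  r + r + 1            ≡⟨ +-assoc r r 1 ⟩
  r + (r + 1)          ≡⟨ cong (r +_) (+-comm r 1) ⟩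
  r + suc r            ≤⟨ +-monoʳ-≤ r r<j ⟩
  r + j                ∎
  where open ≤-Reasoning
... | inj₂ refl rewrite c-at-j refl = ≤-reflexive (+-identityʳ (r + r))

double+bit-above : ∀ {r j} c → j ≤ r → (r ≡ j → c ≡ true) → suc (r + j) ≤ r + r + indicator c
double+bit-above {r} {j} c j≤r c-at-j with m≤n⇒m<n∨m≡n j≤r
... | inj₁ j<r = begin
  suc (r + j)          ≡⟨ +-suc r j ⟨
  r + suc j            ≤⟨ +-monoʳ-≤ r j<r ⟩
  r + r                ≤⟨ m≤m+n (r + r) _ ⟩
  r + r + indicator c  ∎
  where open ≤-Reasoning
... | inj₂ refl rewrite c-at-j refl = ≤-reflexive (sym (+-comm (r + r) 1))

bits : (ℕ → Bool) → ℕ → ℕ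
bits b r = suc (r + r + indicator (b r))

query : ℕ → ℕ → ℕ
query j r = suc (suc (j + j + r))

bits-mono : ∀ b → bits b Preserves _<_ ⟶ _<_
bits-mono b {r} {r′} r<r′ = s≤s (double+bit-mono (b r) (b r′) r<r′)

query-mono : ∀ j → query j Preserves _<_ ⟶ _<_
query-mono j r<r′ = s≤s (s≤s (+-monoʳ-< (j + j) r<r′))

bits-≤ : ∀ b {r K} → r < K → bits b r ≤ K + K
bits-≤ b {r} {K} r<K = ≤-trans (double+bit-mono (b r) false r<K) (≤-reflexive (+-identityʳ (K + K)))

query-≤ : ∀ {j r K} → j < K → r < K → query j r ≤ K + K + K
query-≤ {j} {r} {K} j<K r<K = begin
  suc (suc (j + j + r))  ≡⟨ cong (λ m → suc (m + r)) (+-suc j j) ⟨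
  suc j + suc j + r      ≤⟨ +-mono-≤ (+-mono-≤ j<K j<K) (<⇒≤ r<K) ⟩
  K + K + K              ∎
  where open ≤-Reasoning

bits<query : ∀ b {r j} r′ → r ≤ j → b j ≡ false → bits b r < query j r′
bits<query b {r} {j} r′ r≤j bj = s≤s (s≤s (begin
  r + r + indicator (b r)  ≤⟨ double+bit-below (b r) r≤j (λ { refl → bj }) ⟩
  r + j                    ≤⟨ +-monoˡ-≤ j r≤j ⟩
  j + j                    ≤⟨ m≤m+n (j + j) r′ ⟩
  j + j + r′               ∎))
  where open ≤-Reasoning

bits<query⇒ : ∀ b {r j} r′ → b j ≡ true → bits b r < query j r′ → r < j + r′
bits<query⇒ b {r} {j} r′ bj (s≤s (s≤s bits≤)) with r <? j
... | yes r<j = ≤-trans r<j (m≤m+n j r′)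
... | no  r≮j = +-cancelˡ-< j r (j + r′) (begin-strict
  j + r                    ≡⟨ +-comm j r ⟩
  r + j                    <⟨ double+bit-above (b r) (≮⇒≥ r≮j) (λ { refl → bj }) ⟩
  r + r + indicator (b r)  ≤⟨ bits≤ ⟩
  j + j + r′               ≡⟨ +-assoc j j r′ ⟩
  j + (j + r′)             ∎)
  where open ≤-Reasoning

query<bits : ∀ b {r r′ j K} → r < K → j ≤ r′ → b j ≡ true → query j r < K + bits b r′
query<bits b {r} {r′} {j} {K} r<K j≤r′ bj = begin-strict
  suc (suc (j + j + r))             ≡⟨ cong suc (+-suc (j + j) r) ⟨
  suc (j + j) + suc r               ≤⟨ +-mono-≤ (≤-trans (s≤s (+-monoˡ-≤ j j≤r′))
                                                         (double+bit-above (b r′) j≤r′ (λ { refl → bj })))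
                                                r<K ⟩
  r′ + r′ + indicator (b r′) + K    ≡⟨ +-comm _ K ⟩
  K + (r′ + r′ + indicator (b r′))  <⟨ +-monoʳ-< K (n<1+n _) ⟩
  K + bits b r′                     ∎
  where open ≤-Reasoning

query<bits⇒ : ∀ b {r r′ j K} → j < K → r < K → b j ≡ false → query j r < K + bits b r′ → suc r < K ∸ j + r′
query<bits⇒ b {r} {r′} {j} {K} j<K r<K bj query< with j <? r′
... | yes j<r′ = begin-strict
  suc r      ≤⟨ r<K ⟩
  K          ≡⟨ m∸n+n≡m (<⇒≤ j<K) ⟨
  K ∸ j + j  <⟨ +-monoʳ-< (K ∸ j) j<r′ ⟩
  K ∸ j + r′ ∎
  where open ≤-Reasoning
... | no  j≮r′ = +-cancelʳ-< (j + j) (suc r) (K ∸ j + r′) (begin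
  suc (suc r + (j + j))             ≡⟨ cong (λ m → suc (suc m)) (+-comm r (j + j)) ⟩
  query j r                         ≤⟨ s≤s⁻¹ (subst (suc (query j r) ≤_) (+-suc K _) query<) ⟩
  K + (r′ + r′ + indicator (b r′))  ≤⟨ +-monoʳ-≤ K (double+bit-below (b r′) (≮⇒≥ j≮r′) (λ { refl → bj })) ⟩
  K + (r′ + j)                      ≡⟨ cong (_+ (r′ + j)) (m∸n+n≡m (<⇒≤ j<K)) ⟨
  (K ∸ j + j) + (r′ + j)            ≡⟨ interchange (K ∸ j) j r′ j ⟩
  (K ∸ j + r′) + (j + j)            ∎)
  where open ≤-Reasoning

-- The reduction from INDEX

module Alice {n : ℕ} (π : Permutation′ n) (h : ℕ) where

  alice : ℕ → Bool
  alice p with p <? n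
  ... | yes p<n = toℕ (π ⟨$⟩ˡ fromℕ< p<n) <ᵇ h
  ... | no  _   = false

  alice-π : ∀ t → alice (toℕ (π ⟨$⟩ʳ t)) ≡ (toℕ t <ᵇ h)
  alice-π t with toℕ (π ⟨$⟩ʳ t) <? n
  ... | yes πt<n = trans (cong (λ i → toℕ (π ⟨$⟩ˡ i) <ᵇ h) (F.fromℕ<-toℕ _ πt<n))
                         (cong (λ i → toℕ i <ᵇ h) (inverseˡ π))
  ... | no  πt≮n = ⊥-elim (πt≮n (F.toℕ<n _))

  count-alice : h ≤ n → count alice n ≡ h
  count-alice h≤n = trans (count-permute alice (_<ᵇ h) π alice-π) (trans (count-<ᵇ h n) (m≤n⇒m⊓n≡m h≤n))

-- The positions in A carry the bits b, the others the index j, and the input has an increasing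
-- subsequence longer than threshold j exactly when b j is false.
record IndexReduction (n K : ℕ) (A : ℕ → Bool) : Set where
  field
    input     : (ℕ → Bool) → ℕ → ℕ → ℕ
    bounded   : ∀ b j → j < K → ∀ p → input b j p ≤ n
    prefix    : ∀ b j j′ p → A p ≡ true → input b j p ≡ input b j′ p
    suffix    : ∀ b b′ j p → A p ≡ false → input b j p ≡ input b′ j p
    threshold : ℕ → ℕ
    long      : ∀ b j → j < K → b j ≡ false →
                IncSubseq ℕₛ (λ (p : Fin n) → input b j (toℕ p)) (suc (threshold j))
    short     : ∀ b j → j < K → b j ≡ true → ∀ {k} →
                IncSubseq ℕₛ (λ (p : Fin n) → input b j (toℕ p)) k → k ≤ threshold j

module _ (O : StrictTotalOrder 0ℓ 0ℓ 0ℓ) {n s : ℕ} (π : Permutation′ n)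
         (alg : StreamAlg (StrictTotalOrder.Carrier O) n s) (computes : ComputesLIS O alg π)
         (letters : CardGt O n) where

  index-reduction⇒≤ : ∀ h {K} → IndexReduction n K (Alice.alice π h) → K ≤ s
  index-reduction⇒≤ h {K} R = fooling-bound K x prefix′ suffix′ distinguish
    where
    open IndexReduction R
    open Alice π h
    open Stream alg π h
    open Letters O (proj₁ (increasing-letters O letters)) (proj₂ (increasing-letters O letters))

    x : (ℕ → Bool) → ℕ → Fin n → StrictTotalOrder.Carrier O
    x b j p = letter (input b j (toℕ p))

    prefix′ : ∀ b j j′ t → toℕ t < h → x b j (π ⟨$⟩ʳ t) ≡ x b j′ (π ⟨$⟩ʳ t)
    prefix′ b j j′ t t<h = cong letter (prefix b j j′ _ (trans (alice-π t) (<⇒<ᵇ≡true t<h)))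

    suffix′ : ∀ b b′ j t → h ≤ toℕ t → x b j (π ⟨$⟩ʳ t) ≡ x b′ j (π ⟨$⟩ʳ t)
    suffix′ b b′ j t h≤t = cong letter (suffix b b′ j _ (trans (alice-π t) (≥⇒<ᵇ≡false h≤t)))

    distinguish : ∀ b b′ j → j < K → b j ≡ false → b′ j ≡ true →
                  runAlg alg π (x b j) ≢ runAlg alg π (x b′ j)
    distinguish b b′ j j<K bj b′j same = <-irrefl refl (begin
      suc (threshold j)          ≤⟨ lower ⟩
      runAlg alg π (x b j)       ≡⟨ same ⟩
      runAlg alg π (x b′ j)      ≤⟨ upper ⟩
      threshold j                ∎)
      where
      open ≤-Reasoning
      lower : suc (threshold j) ≤ runAlg alg π (x b j)
      lower = proj₂ (computes (x b j)) _
                (IncSubseq-letter (λ p → input b j (toℕ p)) (bounded b j j<K ∘ toℕ) (long b j j<K bj))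
      upper : runAlg alg π (x b′ j) ≤ threshold j
      upper = short b′ j j<K b′j
                (IncSubseq-unletter (λ p → input b′ j (toℕ p)) (bounded b′ j j<K ∘ toℕ)
                                    (proj₁ (computes (x b′ j))))

module Regions (n h K : ℕ) (A : ℕ → Bool) (count-A : count A n ≡ h)
               (h+h≤n : h + h ≤ n) (K+K<h : K + K < h) where

  bob : ℕ → Bool
  bob p = not (A p)

  -- Position 0 is kept out of both blocks: as a filler of value 0 it starts every chain.
  low high early : (ℕ → Bool) → ℕ → Bool
  low   X p = X p ∧ (p <ᵇ h)
  high  X p = X p ∧ not (p <ᵇ h)
  early X p = low X p ∧ (0 <ᵇ p)

  private
    0<h : 0 < h
    0<h = <-≤-trans (s≤s z≤n) K+K<h

    0<n : 0 < n
    0<n = <-≤-trans 0<h (≤-trans (m≤m+n h h) h+h≤n)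

    3K≤n : K + K + K ≤ n
    3K≤n = begin
      K + K + K       ≤⟨ +-monoʳ-≤ (K + K) (m≤m+n K K) ⟩
      K + K + (K + K) ≤⟨ +-mono-≤ (<⇒≤ K+K<h) (<⇒≤ K+K<h) ⟩
      h + h           ≤⟨ h+h≤n ⟩
      n               ∎
      where open ≤-Reasoning

    h≤n : h ≤ n
    h≤n = ≤-trans (m≤m+n h h) h+h≤n

    low+high : ∀ X → count X n ≡ count (low X) n + count (high X) n
    low+high X = count-∧-split X (_<ᵇ h) n

    alice-low+high : count (low A) n + count (high A) n ≡ h
    alice-low+high = trans (sym (low+high A)) count-A

    low-alice+bob : count (low A) n + count (low bob) n ≡ h
    low-alice+bob = begin
      count (low A) n + count (low bob) n
        ≡⟨ cong₂ _+_ (count-cong n λ p _ → ∧-comm (A p) _) (count-cong n λ p _ → ∧-comm (bob p) _) ⟩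
      count (λ p → (p <ᵇ h) ∧ A p) n + count (λ p → (p <ᵇ h) ∧ not (A p)) n
        ≡⟨ count-∧-split (_<ᵇ h) A n ⟨
      count (_<ᵇ h) n
        ≡⟨ count-<ᵇ h n ⟩
      h ⊓ n
        ≡⟨ m≤n⇒m⊓n≡m h≤n ⟩
      h ∎
      where open ≡-Reasoning

    alice+bob : h + (count (low bob) n + count (high bob) n) ≡ n
    alice+bob = begin
      h + (count (low bob) n + count (high bob) n) ≡⟨ cong₂ _+_ count-A (low+high bob) ⟨
      count A n + count bob n                      ≡⟨ count-∧-split (λ _ → true) A n ⟨
      count (λ _ → true) n                         ≡⟨ count-true n ⟩
      n                                            ∎
      where open ≡-Reasoning

    early≤low : ∀ X → count (early X) n ≤ count (low X) n
    early≤low X = count-≤ n (λ _ → proj₁ ∘ ∧-≡true)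

    low≤1+early : ∀ X → count (low X) n ≤ suc (count (early X) n)
    low≤1+early X = begin
      count (low X) n
        ≡⟨ count-∧-split (low X) (0 <ᵇ_) n ⟩
      count (early X) n + count (λ p → low X p ∧ not (0 <ᵇ p)) n
        ≤⟨ +-monoʳ-≤ (count (early X) n) (count-≤ n origin) ⟩
      count (early X) n + count (_<ᵇ 1) n
        ≤⟨ +-monoʳ-≤ (count (early X) n) (≤-reflexive (count-<ᵇ 1 n)) ⟩
      count (early X) n + 1 ⊓ n
        ≤⟨ +-monoʳ-≤ (count (early X) n) (m⊓n≤m 1 n) ⟩
      count (early X) n + 1
        ≡⟨ +-comm _ 1 ⟩
      suc (count (early X) n) ∎
      where
      open ≤-Reasoning
      origin : ∀ p → (low X p ∧ not (0 <ᵇ p)) ≡ true → (p <ᵇ 1) ≡ true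
      origin zero    _ = refl
      origin (suc p) lowX∧false with () ← trans (sym (∧-zeroʳ (low X (suc p)))) lowX∧false

    more-than-K : ∀ {a x} → a ≤ K → a + x ≡ h → K < x
    more-than-K {a} {x} a≤K a+x≡h = +-cancelˡ-< a K x (begin-strict
      a + K ≤⟨ +-monoˡ-≤ K a≤K ⟩
      K + K <⟨ K+K<h ⟩
      h     ≡⟨ a+x≡h ⟨
      a + x ∎)
      where open ≤-Reasoning

  enough-room : (K ≤ count (early A) n × K ≤ count (high bob) n)
              ⊎ (K ≤ count (early bob) n × K ≤ count (high A) n)
  enough-room with K ≤? count (early A) n
  ... | yes K≤eA = inj₁ (K≤eA , ≤-trans K≤eA (≤-trans (early≤low A) lowA≤highB))
    where
    lowA≤highB : count (low A) n ≤ count (high bob) n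
    lowA≤highB = +-cancelʳ-≤ (count (low bob) n) _ _ (+-cancelˡ-≤ h _ _ (begin
      h + (count (low A) n + count (low bob) n)      ≡⟨ cong (h +_) low-alice+bob ⟩
      h + h                                         ≤⟨ h+h≤n ⟩
      n                                             ≡⟨ alice+bob ⟨
      h + (count (low bob) n + count (high bob) n)  ≡⟨ cong (h +_) (+-comm (count (low bob) n) _) ⟩
      h + (count (high bob) n + count (low bob) n)  ∎))
      where open ≤-Reasoning
  ... | no  K≰eA = inj₂ (≤-pred (≤-trans (more-than-K lowA≤K low-alice+bob) (low≤1+early bob))
                        , <⇒≤ (more-than-K lowA≤K alice-low+high))
    where
    lowA≤K : count (low A) n ≤ K
    lowA≤K = ≤-trans (low≤1+early A) (≰⇒> K≰eA)

  module Blocks (X Y : ℕ → Bool) where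

    E L : ℕ → Bool
    E = take K (early X)
    L = take K (high Y)

    E-low : ∀ {p} → E p ≡ true → X p ≡ true × p < h
    E-low Ep with ∧-≡true (take-⊆ K (early X) Ep)
    ... | lowX , _ with ∧-≡true lowX
    ...   | Xp , p<h = Xp , <ᵇ≡true⇒< p<h

    L-high : ∀ {p} → L p ≡ true → Y p ≡ true × h ≤ p
    L-high Lp with ∧-≡true (take-⊆ K (high Y) Lp)
    ... | Yp , p≮h = Yp , <ᵇ≡false⇒≥ (not≡true⇒≡false p≮h)

    E0 : E 0 ≡ false
    E0 = cong (_∧ _) (∧-zeroʳ (low X 0))

    L0 : L 0 ≡ false
    L0 = cong (_∧ _) (trans (cong (λ b → Y 0 ∧ not b) (<⇒<ᵇ≡true 0<h)) (∧-zeroʳ (Y 0)))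

    count-E : K ≤ count (early X) n → count E n ≡ K
    count-E K≤ = trans (count-take K (early X) n) (m≤n⇒m⊓n≡m K≤)

    count-L : K ≤ count (high Y) n → count L n ≡ K
    count-L K≤ = trans (count-take K (high Y) n) (m≤n⇒m⊓n≡m K≤)

    E-false : ∀ {p} → X p ≡ false → E p ≡ false
    E-false {p} Xp with E p in Ep
    ... | true  with () ← trans (sym Xp) (proj₁ (E-low Ep))
    ... | false = refl

    L-false : ∀ {p} → Y p ≡ false → L p ≡ false
    L-false {p} Yp with L p in Lp
    ... | true  with () ← trans (sym Yp) (proj₁ (L-high Lp))
    ... | false = refl

    open TwoBlocks E L K (λ Ep Lq → <-≤-trans (proj₂ (E-low Ep)) (proj₂ (L-high Lq)))
                         (take-rank K (early X)) (take-rank K (high Y)) public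

  module EarlyBits (room : K ≤ count (early A) n × K ≤ count (high bob) n) where
    open Blocks A bob

    input : (ℕ → Bool) → ℕ → ℕ → ℕ
    input b j = word (bits b) (query j)

    input-≤ : ∀ b j → j < K → ∀ p → input b j p ≤ n
    input-≤ b j j<K p = ≤-trans (s≤s⁻¹ (word-< z<s bits<1+3K query<1+3K p)) 3K≤n
      where
      bits<1+3K : ∀ r → r < K → bits b r < suc (K + K + K)
      bits<1+3K r r<K = s≤s (≤-trans (bits-≤ b r<K) (m≤m+n (K + K) K))
      query<1+3K : ∀ r → r < K → query j r < suc (K + K + K)
      query<1+3K r r<K = s≤s (query-≤ j<K r<K)

    long : ∀ b j → j < K → b j ≡ false →
           IncSubseq ℕₛ (λ (p : Fin n) → input b j (toℕ p)) (suc (suc (j + K)))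
    long b j j<K bj = subst (IncSubseq ℕₛ (λ (p : Fin n) → input b j (toℕ p))) length
      (word-chain n (take (suc j) E) L 0<n E0 L0 (take-⊆ (suc j) E) (λ Lq → Lq)
                  (bits-mono b) (query-mono j) prefix<query (λ _ → z<s) (λ _ → z<s))
      where
      length : suc (count (take (suc j) E) n + count L n) ≡ suc (suc (j + K))
      length = cong suc (cong₂ _+_
        (trans (count-take (suc j) E n) (trans (cong (suc j ⊓_) (count-E (proj₁ room))) (m≤n⇒m⊓n≡m j<K)))
        (count-L (proj₂ room)))
      prefix<query : ∀ {p q} → take (suc j) E p ≡ true → L q ≡ true → bits b (count E p) < query j (count L q)
      prefix<query E′p _ = bits<query b _ (s≤s⁻¹ (take-< (suc j) E E′p)) bj

    short : ∀ b j → j < K → b j ≡ true → ∀ {k} →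
            IncSubseq ℕₛ (λ (p : Fin n) → input b j (toℕ p)) k → k ≤ suc (j + K)
    short b j j<K bj =
      potential-bound ℕₛ (λ p → input b j (toℕ p)) (λ p → potential (toℕ p))
                      (λ _ _ → increasing) (λ p → bounded (toℕ p))
      where
      potential : ℕ → ℕ
      potential = word suc (λ r → suc (j + r))
      increasing : ∀ {p q} → p < q → input b j p < input b j q → potential p < potential q
      increasing = word-potential s≤s (s≤s ∘ +-monoʳ-< j) (λ _ r′ _ _ → s≤s ∘ bits<query⇒ b r′ bj)
                                  (λ _ → z<s) (λ _ → z<s)
      bounded : ∀ p → potential p < suc (j + K)
      bounded = word-< z<s (λ r r<K → s≤s (≤-trans r<K (m≤n+m K j))) (λ r r<K → s≤s (+-monoʳ-< j r<K))

    reduction : IndexReduction n K A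
    reduction = record
      { input     = input
      ; bounded   = input-≤
      ; prefix    = λ b j j′ p Ap → word-cong-late (bits b) (query j) (query j′) (L-false (cong not Ap))
      ; suffix    = λ b b′ j p Ap → word-cong-early (bits b) (bits b′) (query j) (E-false Ap)
      ; threshold = λ j → suc (j + K)
      ; long      = long
      ; short     = short
      }

  module LateBits (room : K ≤ count (early bob) n × K ≤ count (high A) n) where
    open Blocks bob A

    -- Behind the query block the bits are stored negated, so that the run through all of E and
    -- the L-ranks ≥ j is increasing exactly when b j is false.
    shifted-bits : (ℕ → Bool) → ℕ → ℕ
    shifted-bits b r = K + bits (not ∘ b) r

    input : (ℕ → Bool) → ℕ → ℕ → ℕ
    input b j = word (query j) (shifted-bits b)

    input-≤ : ∀ b j → j < K → ∀ p → input b j p ≤ n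
    input-≤ b j j<K p = ≤-trans (s≤s⁻¹ (word-< z<s query<1+3K shifted<1+3K p)) 3K≤n
      where
      query<1+3K : ∀ r → r < K → query j r < suc (K + K + K)
      query<1+3K r r<K = s≤s (query-≤ j<K r<K)
      shifted<1+3K : ∀ r → r < K → shifted-bits b r < suc (K + K + K)
      shifted<1+3K r r<K = s≤s (≤-trans (+-monoʳ-≤ K (bits-≤ (not ∘ b) r<K)) (≤-reflexive (sym (+-assoc K K K))))

    long : ∀ b j → j < K → b j ≡ false →
           IncSubseq ℕₛ (λ (p : Fin n) → input b j (toℕ p)) (suc (K + (K ∸ j)))
    long b j j<K bj = subst (IncSubseq ℕₛ (λ (p : Fin n) → input b j (toℕ p))) length
      (word-chain n E (drop j L) 0<n E0 L0 (λ Ep → Ep) (drop-⊆ j L)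
                  (query-mono j) (+-monoʳ-< K ∘ bits-mono (not ∘ b)) query<suffix
                  (λ _ → z<s) (λ _ → ≤-trans z<s (m≤n+m _ K)))
      where
      length : suc (count E n + count (drop j L) n) ≡ suc (K + (K ∸ j))
      length = cong suc (cong₂ _+_ (count-E (proj₁ room))
        (trans (count-drop j L n (≤-trans (<⇒≤ j<K) (≤-reflexive (sym (count-L (proj₂ room))))))
               (cong (_∸ j) (count-L (proj₂ room)))))
      query<suffix : ∀ {p q} → E p ≡ true → drop j L q ≡ true → query j (count E p) < shifted-bits b (count L q)
      query<suffix Ep L′q = query<bits (not ∘ b) (take-rank K (early bob) Ep) (drop-≥ j L L′q) (cong not bj)

    short : ∀ b j → j < K → b j ≡ true → ∀ {k} →
            IncSubseq ℕₛ (λ (p : Fin n) → input b j (toℕ p)) k → k ≤ K + (K ∸ j)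
    short b j j<K bj =
      potential-bound ℕₛ (λ p → input b j (toℕ p)) (λ p → potential (toℕ p))
                      (λ _ _ → increasing) (λ p → bounded (toℕ p))
      where
      0<K∸j : 0 < K ∸ j
      0<K∸j = m<n⇒0<n∸m j<K
      potential : ℕ → ℕ
      potential = word suc (K ∸ j +_)
      increasing : ∀ {p q} → p < q → input b j p < input b j q → potential p < potential q
      increasing = word-potential s≤s (+-monoʳ-< (K ∸ j))
                     (λ r r′ r<K _ → query<bits⇒ (not ∘ b) j<K r<K (cong not bj))
                     (λ _ → z<s) (λ r′ → ≤-trans 0<K∸j (m≤m+n _ r′))
      bounded : ∀ p → potential p < K + (K ∸ j)
      bounded = word-< (≤-trans 0<K∸j (m≤n+m _ K)) (λ r r<K → ≤-<-trans r<K (m<m+n K 0<K∸j))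
                       (λ r′ r′<K → subst (K ∸ j + r′ <_) (+-comm (K ∸ j) K) (+-monoʳ-< (K ∸ j) r′<K))

    reduction : IndexReduction n K A
    reduction = record
      { input     = input
      ; bounded   = input-≤
      ; prefix    = λ b j j′ p Ap → word-cong-early (query j) (query j′) (shifted-bits b) (E-false (cong not Ap))
      ; suffix    = λ b b′ j p Ap → word-cong-late (query j) (shifted-bits b) (shifted-bits b′) (L-false Ap)
      ; threshold = λ j → K + (K ∸ j)
      ; long      = long
      ; short     = short
      }

lis-memory-lower-bound : ∀ (O : StrictTotalOrder 0ℓ 0ℓ 0ℓ) {n s} (π : Permutation′ n)
                         (alg : StreamAlg (StrictTotalOrder.Carrier O) n s) → ComputesLIS O alg π →
                         CardGt O n → ∀ {h K} → K + K < h → h + h ≤ n → K ≤ s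
lis-memory-lower-bound O {n} π alg computes letters {h} {K} K+K<h h+h≤n =
  [ index-reduction⇒≤ O π alg computes letters h ∘ EarlyBits.reduction
  , index-reduction⇒≤ O π alg computes letters h ∘ LateBits.reduction
  ]′ enough-room
  where
  open Regions n h K (Alice.alice π h) (Alice.count-alice π h (≤-trans (m≤m+n h h) h+h≤n)) h+h≤n K+K<h

6*[n/6]≤n : ∀ n → (n / 6 + n / 6 + n / 6) + (n / 6 + n / 6 + n / 6) ≤ n
6*[n/6]≤n n = ≤-trans (≤-reflexive (six-K (n / 6))) (m/n*n≤m n 6)
  where
  six-K : ∀ K → K + K + K + (K + K + K) ≡ K * 6
  six-K = solve-∀

n≤11*[n/6] : ∀ {n} → 6 ≤ n → n ≤ 11 * (n / 6)
n≤11*[n/6] {n} 6≤n = begin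
  n                        ≡⟨ m≡m%n+[m/n]*n n 6 ⟩
  n % 6 + n / 6 * 6        ≤⟨ +-monoˡ-≤ (n / 6 * 6) (s≤s⁻¹ (m%n<n n 6)) ⟩
  5 + n / 6 * 6            ≤⟨ +-monoˡ-≤ (n / 6 * 6) (*-monoʳ-≤ 5 (/-monoˡ-≤ 6 6≤n)) ⟩
  5 * (n / 6) + n / 6 * 6  ≡⟨ eleven-K (n / 6) ⟩
  11 * (n / 6)             ∎
  where
  open ≤-Reasoning
  eleven-K : ∀ K → 5 * K + K * 6 ≡ 11 * K
  eleven-K = solve-∀

corollary2 : ∃[ C ] ∃[ n₀ ] (∀ (n : ℕ) → n₀ ≤ n → (O : StrictTotalOrder 0ℓ 0ℓ 0ℓ) → CardGt O n → (π : Permutation′ n) → (s : ℕ) → (alg : StreamAlg (StrictTotalOrder.Carrier O) n s) → ComputesLIS O alg π → n ≤ C * s)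
corollary2 = 11 , 6 , λ n 6≤n O letters π s alg computes →
  ≤-trans (n≤11*[n/6] 6≤n)
          (*-monoʳ-≤ 11 {n / 6} (lis-memory-lower-bound O π alg computes letters {n / 6 + n / 6 + n / 6}
                                   (m<m+n (n / 6 + n / 6) (/-monoˡ-≤ 6 6≤n)) (6*[n/6]≤n n)))
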